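{- At the beginning of each update, every vertex $v$ satisfies the following. If $\ell(v)\ge 0$, then when $v$ was last recolored (before the current time), its color was chosen uniformly at random from a palette of size at least $3^{\ell(v)+1}/2+1$, and at that time $v$ had at least $3^{\ell(v)+1}$ down-neighbors. If $\ell(v)=-1$, the current color of $v$ was set deterministically.
   Context: Setting: $G=(V,E)$ is a dynamic graph on a fixed set $V$ of $n$ vertices that starts with no edges and undergoes a sequence of updates, each the insertion or deletion of one edge. A fixed integer $\Delta>0$ upper-bounds the maximum degree of $G$ at all times, and $\mathcal{C}=\{1,\dots,\Delta+1\}$ is the set of colors. Let $L=\lceil\log_3(n-1)\rceil-1$. The algorithm maintains a coloring $\chi:V\to\mathcal{C}$ and a level $\ell(v)\in\{ -1,0,\dots,L\}$ for each vertex $v$. For an edge $uv$, $u$ is an up-neighbor of $v$ if $\ell(u)\ge\ell(v)$ and a down-neighbor of $v$ if $\ell(u)<\ell(v)$. For a level $k$, $\phi_v(k)$ is the number of neighbors $u$ of $v$ with $\ell(u)<k$. A color $c$ is blank for $v$ if no neighbor of $v$ has color $c$, and unique for $v$ if no up-neighbor of $v$ has color $c$ and exactly one down-neighbor of $v$ has color $c$. Algorithm: initially every vertex is at level $-1$ with an arbitrary (deterministic) color. A deletion changes nothing. On insertion of an edge $uv$: if $\chi(u)\neq\chi(v)$ nothing changes; otherwise let $x$ be the endpoint among $u,v$ that was recolored most recently, and repeat $x\leftarrow\texttt{recolor}(x)$ until $x=\mathrm{NULL}$. The procedure $\texttt{recolor}(x)$: if $\phi_x(\ell(x)+1)<3^{\ell(x)+2}$,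 call $\texttt{det-color}(x)$, which assigns to $x$ a blank color (chosen deterministically), sets $\ell(x)=-1$, and then return NULL. Otherwise call $\texttt{rand-color}(x)$, which: lets $\ell'$ be the minimum level $\ell'>\ell(x)$ with $\phi_x(\ell'+1)<3^{\ell'+2}$ and sets $\ell(x)=\ell'$; lets the palette $\mathcal{C}^*_x$ be the set of colors that are blank or unique for $x$; picks $c\in\mathcal{C}^*_x$ uniformly at random and sets $\chi(x)=c$; returns NULL if $c$ is blank for $x$, and otherwise returns the unique down-neighbor $y$ of $x$ with $\chi(y)=c$. -}

module Defs where

open import Data.Nat using (ℕ; zero; suc; _+_; _*_; _^_; _≤_; _<_; _<ᵇ_; _≤ᵇ_; _≡ᵇ_)
open import Data.Bool using (Bool; true; false; _∧_; _∨_; not; if_then_else_)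
open import Data.Fin using (Fin; _≟_)
open import Data.List using (List; []; _∷_; allFin)
open import Data.Product using (_×_; _,_)
open import Data.Sum using (_⊎_)
open import Relation.Nullary using (¬_)
open import Relation.Nullary.Decidable using (⌊_⌋)
open import Relation.Binary.PropositionalEquality using (_≡_; _≢_)

countᵇ : {A : Set} → (A → Bool) → List A → ℕ
countᵇ p [] = 0
countᵇ p (x ∷ xs) = if p x then suc (countᵇ p xs) else countᵇ p xs

_==ᶠ_ : ∀ {m} → Fin m → Fin m → Bool
i ==ᶠ j = ⌊ i ≟ j ⌋

upd : ∀ {n} {A : Set} → (Fin n → A) → Fin n → A → Fin n → A
upd f x a y = if y ==ᶠ x then a else f y

-- Bookkeeping: how the current colour of a vertex was last set.
--   det          : set deterministically (initial colour, or det-color)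
--   rand p d     : set by rand-color, drawing uniformly from a palette of
--                  size p, while the vertex had d down-neighbours
--                  (both measured at the moment of that recolouring).
data LastRecolor : Set where
  det  : LastRecolor
  rand : (paletteSize downNeighbours : ℕ) → LastRecolor

-- Algorithm state.  Vertices: Fin n.  Colours: Fin (suc Δ), representing
-- {1,…,Δ+1}.  LEVELS ARE SHIFTED BY ONE: lvl v = ℓ(v) + 1, so paper level
-- -1 is lvl 0 and paper level k ≥ 0 is lvl (k+1).
record State (n Δ : ℕ) : Set where
  field
    adj   : Fin n → Fin n → Bool      -- edge relation (symmetric, irreflexive)
    col   : Fin n → Fin (suc Δ)
    lvl   : Fin n → ℕ
    stamp : Fin n → ℕ                 -- time of last recolouring (0 = never)
    clock : ℕ
    last  : Fin n → LastRecolor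
open State public

module _ {n Δ : ℕ} where

  deg : State n Δ → Fin n → ℕ
  deg s v = countᵇ (adj s v) (allFin n)

  -- phiSh s v K = #{neighbours u of v : lvl u < K} = φ_v(K - 1) in the paper
  phiSh : State n Δ → Fin n → ℕ → ℕ
  phiSh s v K = countᵇ (λ u → adj s v u ∧ (lvl s u <ᵇ K)) (allFin n)

  downCount : State n Δ → Fin n → ℕ
  downCount s v = phiSh s v (lvl s v)

  -- Low s x k  (k a shifted level, paper level k-1):
  --   φ_x(paper-level + 1) < 3^(paper-level + 2)
  Low : State n Δ → Fin n → ℕ → Set
  Low s x k = phiSh s x (suc k) < 3 ^ suc k

  nbCol upCol downCol : State n Δ → Fin n → Fin (suc Δ) → ℕ
  nbCol s v c = countᵇ (λ u → adj s v u ∧ (col s u ==ᶠ c)) (allFin n)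
  upCol s v c =
    countᵇ (λ u → adj s v u ∧ (lvl s v ≤ᵇ lvl s u) ∧ (col s u ==ᶠ c)) (allFin n)
  downCol s v c =
    countᵇ (λ u → adj s v u ∧ (lvl s u <ᵇ lvl s v) ∧ (col s u ==ᶠ c)) (allFin n)

  blank unique inPalette : State n Δ → Fin n → Fin (suc Δ) → Bool
  blank s v c = nbCol s v c ≡ᵇ 0
  unique s v c = (upCol s v c ≡ᵇ 0) ∧ (downCol s v c ≡ᵇ 1)
  inPalette s v c = blank s v c ∨ unique s v c

  paletteSize : State n Δ → Fin n → ℕ
  paletteSize s v = countᵇ (inPalette s v) (allFin (suc Δ))

  setLvl : State n Δ → Fin n → ℕ → State n Δ
  setLvl s x k = record s { lvl = upd (lvl s) x k }

  recolorAt : State n Δ → Fin n → Fin (suc Δ) → LastRecolor → State n Δ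
  recolorAt s x c r = record s
    { col   = upd (col s) x c
    ; stamp = upd (stamp s) x (suc (clock s))
    ; clock = suc (clock s)
    ; last  = upd (last s) x r }

  detColor : State n Δ → Fin n → Fin (suc Δ) → State n Δ
  detColor s x c = recolorAt (setLvl s x 0) x c det

  -- rand-color with new (shifted) level k and drawn colour c; the palette
  -- size and the number of down-neighbours are measured after ℓ(x) := ℓ'
  randColor : State n Δ → Fin n → ℕ → Fin (suc Δ) → State n Δ
  randColor s x k c =
    let s₁ = setLvl s x k in
    recolorAt s₁ x c (rand (paletteSize s₁ x) (downCount s₁ x))

  MinAbove : State n Δ → Fin n → ℕ → Set
  MinAbove s x k =
    lvl s x < k × Low s x k × (∀ j → lvl s x < j → j < k → ¬ Low s x j)

  -- Recolor s x s' : the loop  x ← recolor(x) until NULL, started at x in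
  -- state s, terminates in state s'.  Random / deterministic choices are
  -- modelled nondeterministically (every possible outcome).
  data Recolor : State n Δ → Fin n → State n Δ → Set where
    det-color : ∀ {s x} (c : Fin (suc Δ)) →
      Low s x (lvl s x) → blank s x c ≡ true →
      Recolor s x (detColor s x c)
    rand-blank : ∀ {s x} (k : ℕ) (c : Fin (suc Δ)) →
      ¬ Low s x (lvl s x) → MinAbove s x k →
      blank (setLvl s x k) x c ≡ true →
      Recolor s x (randColor s x k c)
    rand-unique : ∀ {s x s'} (k : ℕ) (c : Fin (suc Δ)) (y : Fin n) →
      ¬ Low s x (lvl s x) → MinAbove s x k →
      blank (setLvl s x k) x c ≡ false →
      unique (setLvl s x k) x c ≡ true →
      adj s x y ≡ true → lvl s y < k → col s y ≡ c →
      Recolor (randColor s x k c) y s' →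
      Recolor s x s'

  setEdge : State n Δ → Fin n → Fin n → Bool → State n Δ
  setEdge s u v b = record s
    { adj = λ a a' → if ((a ==ᶠ u) ∧ (a' ==ᶠ v)) ∨ ((a ==ᶠ v) ∧ (a' ==ᶠ u))
                      then b else adj s a a' }

  Insertable : State n Δ → Fin n → Fin n → Set
  Insertable s u v =
    u ≢ v × adj s u v ≡ false ×
    deg (setEdge s u v true) u ≤ Δ × deg (setEdge s u v true) v ≤ Δ

  data Update : State n Δ → State n Δ → Set where
    delete : ∀ {s} (u v : Fin n) → adj s u v ≡ true →
      Update s (setEdge s u v false)
    insert-diff : ∀ {s} (u v : Fin n) → Insertable s u v →
      col s u ≢ col s v → Update s (setEdge s u v true)
    insert-same : ∀ {s s'} (u v x : Fin n) → Insertable s u v →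
      col s u ≡ col s v →
      -- x is the endpoint recoloured most recently (either one on a tie,
      -- which only happens when neither was ever recoloured)
      ((x ≡ u × stamp s v ≤ stamp s u) ⊎ (x ≡ v × stamp s u ≤ stamp s v)) →
      Recolor (setEdge s u v true) x s' →
      Update s s'

  initState : (Fin n → Fin (suc Δ)) → State n Δ
  initState col₀ = record
    { adj = λ _ _ → false ; col = col₀ ; lvl = λ _ → 0
    ; stamp = λ _ → 0 ; clock = 0 ; last = λ _ → det }

  -- states at the beginning of an update (after finitely many updates)
  data Reach (col₀ : Fin n → Fin (suc Δ)) : State n Δ → Set where
    start : Reach col₀ (initState col₀)
    step  : ∀ {s s'} → Reach col₀ s → Update s s' → Reach col₀ s'

module Submission where

-- Every reachable state satisfies an invariant: the graph has no loops,
-- every degree is at most Δ, and every vertex is certified, i.e. how its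
-- colour was last set matches its level (deterministically at paper level
-- -1; otherwise randomly, from a palette of size ≥ 3^(ℓ+1)/2 + 1 while
-- having ≥ 3^(ℓ+1) down-neighbours).  lemma2 just reads off the invariant.
--
-- The heart is the palette bound: if deg x ≤ Δ and x has D down-neighbours,
-- its palette has size p with 2 + D ≤ 2p.  A colour outside the palette is
-- used by an up-neighbour or by two down-neighbours, so it costs 2 in the
-- weighted count 2·(up-neighbours) + (down-neighbours) ≤ 2Δ - D, and there
-- are Δ + 1 - p such colours.  When rand-color moves x to level ℓ', the
-- minimality of ℓ' gives ≥ 3^(ℓ'+1) neighbours below ℓ', i.e. down-neighbours
-- at the new level, and the palette bound finishes the certificate.

open import Defs
open import Data.Nat
  using (ℕ; zero; suc; _+_; _*_; _^_; _≤_; _<_; _<ᵇ_; _≤ᵇ_; _≡ᵇ_; z≤n; s≤s; s≤s⁻¹)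
open import Data.Nat.Properties
  using (+-*-semiring; ≤-refl; ≤-trans; +-comm; +-mono-≤; +-monoʳ-≤; +-monoˡ-≤;
         *-monoʳ-≤; +-cancelˡ-≤; m≤m+n; m≤n⇒m<n∨m≡n; ≮⇒≥; n<1+n; module ≤-Reasoning)
open import Data.Nat.Tactic.RingSolver using (solve-∀)
open import Algebra.Properties.Semiring.Sum +-*-semiring
  using (sum; sum-syntax; sum-cong-≗; sum-replicate-zero; ∑-distrib-+; ∑-comm;
         *-distribˡ-sum)
open import Data.Bool using (Bool; true; false; _∧_; _∨_; not)
open import Data.Bool.Properties using (∧-assoc; ∧-comm)
import Data.Fin as F
open F using (Fin; _≟_)
open import Data.Fin.Properties using (suc-injective)
open import Data.List using (allFin; tabulate)
open import Data.Product using (Σ; _×_; _,_)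
open import Data.Sum using (inj₁; inj₂)
open import Data.Empty using (⊥-elim)
open import Function using (_∘_; id)
open import Relation.Nullary using (¬_; Dec; yes; no)
open import Relation.Nullary.Decidable using (⌊⌋-map′)
open import Relation.Binary.PropositionalEquality

ind : Bool → ℕ
ind true  = 1
ind false = 0

ind-split : ∀ a b → ind a ≡ ind (a ∧ b) + ind (a ∧ not b)
ind-split false b     = refl
ind-split true  true  = refl
ind-split true  false = refl

ind-complement : ∀ b → ind b + ind (not b) ≡ 1
ind-complement true  = refl
ind-complement false = refl

ind-mono : ∀ {a b} → (a ≡ true → b ≡ true) → ind a ≤ ind b
ind-mono {false}         _    = z≤n
ind-mono {true}  {true}  _    = ≤-refl
ind-mono {true}  {false} a⇒b with () ← a⇒b refl

count-tabulate : ∀ {A : Set} {m} (p : A → Bool) (f : Fin m → A) →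
  countᵇ p (tabulate f) ≡ ∑[ i < m ] ind (p (f i))
count-tabulate {m = zero}  p f = refl
count-tabulate {m = suc m} p f with p (f F.zero)
... | true  = cong suc (count-tabulate p (f ∘ F.suc))
... | false = count-tabulate p (f ∘ F.suc)

count-allFin : ∀ {m} (p : Fin m → Bool) → countᵇ p (allFin m) ≡ ∑[ i < m ] ind (p i)
count-allFin p = count-tabulate p id

count-cong : ∀ {m} {p q : Fin m → Bool} → (∀ i → p i ≡ q i) →
  countᵇ p (allFin m) ≡ countᵇ q (allFin m)
count-cong {p = p} {q} p≗q = begin
  countᵇ p (allFin _)     ≡⟨ count-allFin p ⟩
  sum (λ i → ind (p i))   ≡⟨ sum-cong-≗ (cong ind ∘ p≗q) ⟩
  sum (λ i → ind (q i))   ≡⟨ count-allFin q ⟨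
  countᵇ q (allFin _)     ∎
  where open ≡-Reasoning

∑-mono : ∀ {m} {f g : Fin m → ℕ} → (∀ i → f i ≤ g i) → ∑[ i < m ] f i ≤ ∑[ i < m ] g i
∑-mono {zero}  _   = z≤n
∑-mono {suc m} f≤g = +-mono-≤ (f≤g F.zero) (∑-mono (f≤g ∘ F.suc))

count-mono : ∀ {m} {p q : Fin m → Bool} → (∀ i → p i ≡ true → q i ≡ true) →
  countᵇ p (allFin m) ≤ countᵇ q (allFin m)
count-mono {p = p} {q} p⇒q = begin
  countᵇ p (allFin _)     ≡⟨ count-allFin p ⟩
  sum (λ i → ind (p i))   ≤⟨ ∑-mono (λ i → ind-mono (p⇒q i)) ⟩
  sum (λ i → ind (q i))   ≡⟨ count-allFin q ⟨
  countᵇ q (allFin _)     ∎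
  where open ≤-Reasoning

count-split : ∀ {m} (p q : Fin m → Bool) →
  countᵇ p (allFin m) ≡
  countᵇ (λ i → p i ∧ q i) (allFin m) + countᵇ (λ i → p i ∧ not (q i)) (allFin m)
count-split p q = begin
  countᵇ p (allFin _)
    ≡⟨ count-allFin p ⟩
  sum (λ i → ind (p i))
    ≡⟨ sum-cong-≗ (λ i → ind-split (p i) (q i)) ⟩
  sum (λ i → ind (p i ∧ q i) + ind (p i ∧ not (q i)))
    ≡⟨ ∑-distrib-+ (λ i → ind (p i ∧ q i)) (λ i → ind (p i ∧ not (q i))) ⟩
  sum (λ i → ind (p i ∧ q i)) + sum (λ i → ind (p i ∧ not (q i)))
    ≡⟨ cong₂ _+_ (count-allFin (λ i → p i ∧ q i)) (count-allFin (λ i → p i ∧ not (q i))) ⟨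
  countᵇ (λ i → p i ∧ q i) (allFin _) + countᵇ (λ i → p i ∧ not (q i)) (allFin _) ∎
  where open ≡-Reasoning

∑-ones : ∀ m → ∑[ i < m ] 1 ≡ m
∑-ones zero    = refl
∑-ones (suc m) = cong suc (∑-ones m)

==ᶠ-sound : ∀ {m} {i j : Fin m} → (i ==ᶠ j) ≡ true → i ≡ j
==ᶠ-sound {i = i} {j} eq with i ≟ j
... | yes i≡j = i≡j
==ᶠ-sound () | no _

==ᶠ-refl : ∀ {m} (i : Fin m) → (i ==ᶠ i) ≡ true
==ᶠ-refl i with i ≟ i
... | yes _  = refl
... | no i≢i = ⊥-elim (i≢i refl)

==ᶠ-complete : ∀ {m} {i j : Fin m} → ¬ i ≡ j → (i ==ᶠ j) ≡ false
==ᶠ-complete {i = i} {j} i≢j with i ≟ j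
... | yes i≡j = ⊥-elim (i≢j i≡j)
... | no _    = refl

==ᶠ-suc : ∀ {m} (i j : Fin m) → (F.suc i ==ᶠ F.suc j) ≡ (i ==ᶠ j)
==ᶠ-suc i j = ⌊⌋-map′ (cong F.suc) suc-injective (i ≟ j)

∑-point : ∀ {m} (i : Fin m) → ∑[ j < m ] ind (i ==ᶠ j) ≡ 1
∑-point {suc m} F.zero    = cong suc (sum-replicate-zero m)
∑-point {suc m} (F.suc i) =
  trans (sum-cong-≗ (λ j → cong ind (==ᶠ-suc i j))) (∑-point i)

-- Counting a set class by class: each element of the set P lies in
-- exactly one colour class of κ.
count-by-classes : ∀ {m k} (P : Fin m → Bool) (κ : Fin m → Fin k) →
  ∑[ c < k ] countᵇ (λ u → P u ∧ (κ u ==ᶠ c)) (allFin m) ≡ countᵇ P (allFin m)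
count-by-classes {m} {k} P κ = begin
  ∑[ c < k ] countᵇ (λ u → P u ∧ (κ u ==ᶠ c)) (allFin m)
    ≡⟨ sum-cong-≗ (λ c → count-allFin (λ u → P u ∧ (κ u ==ᶠ c))) ⟩
  ∑[ c < k ] ∑[ u < m ] ind (P u ∧ (κ u ==ᶠ c))
    ≡⟨ ∑-comm (λ c u → ind (P u ∧ (κ u ==ᶠ c))) ⟩
  ∑[ u < m ] ∑[ c < k ] ind (P u ∧ (κ u ==ᶠ c))
    ≡⟨ sum-cong-≗ (λ u → in-one-class (P u) (κ u)) ⟩
  ∑[ u < m ] ind (P u)
    ≡⟨ count-allFin P ⟨
  countᵇ P (allFin m) ∎
  where
  open ≡-Reasoning
  in-one-class : ∀ b i → ∑[ c < k ] ind (b ∧ (i ==ᶠ c)) ≡ ind b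
  in-one-class false i = sum-replicate-zero k
  in-one-class true  i = ∑-point i

not-≤ᵇ : ∀ a b → not (a ≤ᵇ b) ≡ (b <ᵇ a)
not-≤ᵇ zero    zero    = refl
not-≤ᵇ zero    (suc b) = refl
not-≤ᵇ (suc a) zero    = refl
not-≤ᵇ (suc a) (suc b) = trans (cong not (lt-as-le a b)) (not-≤ᵇ a b)
  where
  lt-as-le : ∀ a b → (a <ᵇ suc b) ≡ (a ≤ᵇ b)
  lt-as-le zero    b = refl
  lt-as-le (suc a) b = refl

-- A colour whose up-count is a and down-count is b lies outside the
-- palette only if a ≥ 1 or b ≥ 2; either way it costs 2 in 2a + b.
exclusion-cost : ∀ a b →
  2 * ind (not (((a + b) ≡ᵇ 0) ∨ ((a ≡ᵇ 0) ∧ (b ≡ᵇ 1)))) ≤ 2 * a + b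
exclusion-cost zero    zero          = z≤n
exclusion-cost zero    (suc zero)    = z≤n
exclusion-cost zero    (suc (suc b)) = s≤s (s≤s z≤n)
exclusion-cost (suc a) b             =
  ≤-trans (*-monoʳ-≤ 2 (s≤s (z≤n {a}))) (m≤m+n (2 * suc a) b)

-- p palette colours and q excluded colours make up all Δ + 1 colours;
-- the excluded ones cost 2q ≤ 2U + D where U + D ≤ Δ neighbours.
palette-arithmetic : ∀ {Δ p q U D} → p + q ≡ suc Δ → 2 * q ≤ 2 * U + D → U + D ≤ Δ →
  2 + D ≤ 2 * p
palette-arithmetic {Δ} {p} {q} {U} {D} total excluded bounded =
  +-cancelˡ-≤ (2 * Δ) (2 + D) (2 * p) (begin
    2 * Δ + (2 + D)          ≡⟨ shift Δ D ⟩
    2 * suc Δ + D            ≡⟨ cong (λ t → 2 * t + D) total ⟨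
    2 * (p + q) + D          ≡⟨ distribute p q D ⟩
    2 * p + (2 * q + D)      ≤⟨ +-monoʳ-≤ (2 * p) (+-monoˡ-≤ D excluded) ⟩
    2 * p + (2 * U + D + D)  ≡⟨ regroup p U D ⟩
    2 * p + 2 * (U + D)      ≤⟨ +-monoʳ-≤ (2 * p) (*-monoʳ-≤ 2 bounded) ⟩
    2 * p + 2 * Δ            ≡⟨ +-comm (2 * p) (2 * Δ) ⟩
    2 * Δ + 2 * p            ∎)
  where
  open ≤-Reasoning
  shift : ∀ Δ D → 2 * Δ + (2 + D) ≡ 2 * suc Δ + D
  shift = solve-∀
  distribute : ∀ p q D → 2 * (p + q) + D ≡ 2 * p + (2 * q + D)
  distribute = solve-∀
  regroup : ∀ p U D → 2 * p + (2 * U + D + D) ≡ 2 * p + 2 * (U + D)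
  regroup = solve-∀

Certified : ℕ → LastRecolor → Set
Certified zero    r = r ≡ det
Certified (suc k) r = Σ ℕ λ p → Σ ℕ λ d →
  r ≡ rand p d × 3 ^ suc k + 2 ≤ 2 * p × 3 ^ suc k ≤ d

Loopless : ∀ {n} → (Fin n → Fin n → Bool) → Set
Loopless A = ∀ v → A v v ≡ false

DegreeAtMost : ∀ {n} → ℕ → (Fin n → Fin n → Bool) → Set
DegreeAtMost {n} Δ A = ∀ v → countᵇ (A v) (allFin n) ≤ Δ

module _ {n Δ : ℕ} where

  AllCertified : State n Δ → Set
  AllCertified s = ∀ v → Certified (lvl s v) (last s v)

  record Invariant (s : State n Δ) : Set where
    field
      loopless  : Loopless (adj s)
      degree    : DegreeAtMost Δ (adj s)
      certified : AllCertified s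
  open Invariant

  upNeighbour : State n Δ → Fin n → Fin n → Bool
  upNeighbour s x u = adj s x u ∧ (lvl s x ≤ᵇ lvl s u)

  degree-split : (s : State n Δ) (x : Fin n) →
    deg s x ≡ countᵇ (upNeighbour s x) (allFin n) + downCount s x
  degree-split s x =
    trans (count-split (adj s x) (λ u → lvl s x ≤ᵇ lvl s u))
          (cong (countᵇ (upNeighbour s x) (allFin n) +_)
                (count-cong (λ u → cong (adj s x u ∧_) (not-≤ᵇ (lvl s x) (lvl s u)))))

  nbCol-split : (s : State n Δ) (x : Fin n) (c : Fin (suc Δ)) →
    nbCol s x c ≡ upCol s x c + downCol s x c
  nbCol-split s x c =
    trans (count-split (λ u → adj s x u ∧ (col s u ==ᶠ c)) (λ u → lvl s x ≤ᵇ lvl s u))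
          (cong₂ _+_ (count-cong (λ u → swap-inner (adj s x u) (col s u ==ᶠ c) _))
                     (count-cong (λ u → trans (swap-inner (adj s x u) (col s u ==ᶠ c) _)
                        (cong (λ b → adj s x u ∧ (b ∧ (col s u ==ᶠ c)))
                              (not-≤ᵇ (lvl s x) (lvl s u))))))
    where
    swap-inner : ∀ a e b → (a ∧ e) ∧ b ≡ a ∧ (b ∧ e)
    swap-inner a e b = trans (∧-assoc a e b) (cong (a ∧_) (∧-comm e b))

  upCol-total : (s : State n Δ) (x : Fin n) →
    ∑[ c < suc Δ ] upCol s x c ≡ countᵇ (upNeighbour s x) (allFin n)
  upCol-total s x =
    trans (sum-cong-≗ (λ c → count-cong (λ u →
             sym (∧-assoc (adj s x u) (lvl s x ≤ᵇ lvl s u) (col s u ==ᶠ c)))))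
          (count-by-classes (upNeighbour s x) (col s))

  downCol-total : (s : State n Δ) (x : Fin n) →
    ∑[ c < suc Δ ] downCol s x c ≡ downCount s x
  downCol-total s x =
    trans (sum-cong-≗ (λ c → count-cong (λ u →
             sym (∧-assoc (adj s x u) (lvl s u <ᵇ lvl s x) (col s u ==ᶠ c)))))
          (count-by-classes (λ u → adj s x u ∧ (lvl s u <ᵇ lvl s x)) (col s))

  excluded-colour-cost : (s : State n Δ) (x : Fin n) (c : Fin (suc Δ)) →
    2 * ind (not (inPalette s x c)) ≤ 2 * upCol s x c + downCol s x c
  excluded-colour-cost s x c
    rewrite nbCol-split s x c = exclusion-cost (upCol s x c) (downCol s x c)

  palette-bound : (s : State n Δ) (x : Fin n) → deg s x ≤ Δ →
    2 + downCount s x ≤ 2 * paletteSize s x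
  palette-bound s x deg≤Δ =
    palette-arithmetic {Δ} {paletteSize s x} {Q} {U} {D} total excluded neighbours
    where
    inP = inPalette s x
    Q = ∑[ c < suc Δ ] ind (not (inP c))
    U = countᵇ (upNeighbour s x) (allFin n)
    D = downCount s x
    total : paletteSize s x + Q ≡ suc Δ
    total = begin
      paletteSize s x + Q
        ≡⟨ cong (_+ Q) (count-allFin inP) ⟩
      (∑[ c < suc Δ ] ind (inP c)) + Q
        ≡⟨ ∑-distrib-+ (ind ∘ inP) (λ c → ind (not (inP c))) ⟨
      ∑[ c < suc Δ ] (ind (inP c) + ind (not (inP c)))
        ≡⟨ sum-cong-≗ (ind-complement ∘ inP) ⟩
      ∑[ c < suc Δ ] 1
        ≡⟨ ∑-ones (suc Δ) ⟩
      suc Δ ∎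
      where open ≡-Reasoning
    excluded : 2 * Q ≤ 2 * U + D
    excluded = begin
      2 * Q
        ≡⟨ *-distribˡ-sum 2 (λ c → ind (not (inP c))) ⟩
      ∑[ c < suc Δ ] (2 * ind (not (inP c)))
        ≤⟨ ∑-mono (excluded-colour-cost s x) ⟩
      ∑[ c < suc Δ ] (2 * upCol s x c + downCol s x c)
        ≡⟨ ∑-distrib-+ (λ c → 2 * upCol s x c) (downCol s x) ⟩
      (∑[ c < suc Δ ] (2 * upCol s x c)) + (∑[ c < suc Δ ] downCol s x c)
        ≡⟨ cong₂ _+_ (sym (*-distribˡ-sum 2 (upCol s x))) (downCol-total s x) ⟩
      2 * (∑[ c < suc Δ ] upCol s x c) + D
        ≡⟨ cong (λ t → 2 * t + D) (upCol-total s x) ⟩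
      2 * U + D ∎
      where open ≤-Reasoning
    neighbours : U + D ≤ Δ
    neighbours = subst (_≤ Δ) (degree-split s x) deg≤Δ

  upd-self : {A : Set} (f : Fin n → A) (x : Fin n) (a : A) → upd f x a x ≡ a
  upd-self f x a rewrite ==ᶠ-refl x = refl

  -- Changing x's own level does not change how x sees the levels of its
  -- neighbours, because x is not its own neighbour.
  phiSh-setLvl-self : (s : State n Δ) (x : Fin n) (k K : ℕ) → adj s x x ≡ false →
    phiSh (setLvl s x k) x K ≡ phiSh s x K
  phiSh-setLvl-self s x k K no-loop = count-cong same-view
    where
    same-view : ∀ u → (adj s x u ∧ (upd (lvl s) x k u <ᵇ K)) ≡ (adj s x u ∧ (lvl s u <ᵇ K))
    same-view u with u ==ᶠ x in u=x
    ... | true rewrite ==ᶠ-sound u=x | no-loop = refl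
    ... | false = refl

  downCount-setLvl : (s : State n Δ) (x : Fin n) (k : ℕ) → adj s x x ≡ false →
    downCount (setLvl s x k) x ≡ phiSh s x k
  downCount-setLvl s x k no-loop =
    trans (cong (phiSh (setLvl s x k) x) (upd-self (lvl s) x k))
          (phiSh-setLvl-self s x k k no-loop)

  -- The test of recolor fails at the old level and at every level
  -- strictly between the old and the new one, hence just below the new one.
  not-Low-below : (s : State n Δ) (x : Fin n) (k : ℕ) →
    ¬ Low s x (lvl s x) → MinAbove s x (suc k) → ¬ Low s x k
  not-Low-below s x k not-low-here (above , _ , minimal)
    with m≤n⇒m<n∨m≡n (s≤s⁻¹ above)
  ... | inj₁ between = minimal k between (n<1+n k)
  ... | inj₂ refl    = not-low-here

  -- rand-color to level k records a certificate for k: many down-neighbours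
  -- by minimality of k, hence a large palette by the palette bound.
  rand-certificate : (s : State n Δ) (x : Fin n) (k : ℕ) →
    Loopless (adj s) → DegreeAtMost Δ (adj s) →
    ¬ Low s x (lvl s x) → MinAbove s x k →
    Certified k (rand (paletteSize (setLvl s x k) x) (downCount (setLvl s x k) x))
  rand-certificate s x zero    _       _      _            (() , _)
  rand-certificate s x (suc k) no-loop degree not-low-here min-above =
    _ , _ , refl , large-palette , many-down
    where
    s₁ = setLvl s x (suc k)
    many-down : 3 ^ suc k ≤ downCount s₁ x
    many-down = subst (3 ^ suc k ≤_) (sym (downCount-setLvl s x (suc k) (no-loop x)))
                      (≮⇒≥ (not-Low-below s x k not-low-here min-above))
    large-palette : 3 ^ suc k + 2 ≤ 2 * paletteSize s₁ x
    large-palette = begin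
      3 ^ suc k + 2         ≡⟨ +-comm (3 ^ suc k) 2 ⟩
      2 + 3 ^ suc k         ≤⟨ +-monoʳ-≤ 2 many-down ⟩
      2 + downCount s₁ x    ≤⟨ palette-bound s₁ x (degree x) ⟩
      2 * paletteSize s₁ x  ∎
      where open ≤-Reasoning

  recolorAt-certified : (s : State n Δ) (x : Fin n) (k : ℕ) (c : Fin (suc Δ))
    (r : LastRecolor) → AllCertified s → Certified k r →
    AllCertified (recolorAt (setLvl s x k) x c r)
  recolorAt-certified s x k c r all-certified certified-r v with v ==ᶠ x
  ... | true  = certified-r
  ... | false = all-certified v

  recolor-keeps-edges : ∀ {s : State n Δ} {x s'} → Recolor s x s' → adj s' ≡ adj s
  recolor-keeps-edges (det-color _ _ _)                   = refl
  recolor-keeps-edges (rand-blank _ _ _ _ _)              = refl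
  recolor-keeps-edges (rand-unique _ _ _ _ _ _ _ _ _ _ r) = recolor-keeps-edges r

  recolor-certified : ∀ {s : State n Δ} {x s'} → Loopless (adj s) → DegreeAtMost Δ (adj s) →
    AllCertified s → Recolor s x s' → AllCertified s'
  recolor-certified {s} {x} _ _ all-certified (det-color c _ _) =
    recolorAt-certified s x 0 c det all-certified refl
  recolor-certified {s} {x} no-loop degree all-certified
    (rand-blank k c not-low min-above _) =
    recolorAt-certified s x k c _ all-certified
      (rand-certificate s x k no-loop degree not-low min-above)
  recolor-certified {s} {x} no-loop degree all-certified
    (rand-unique k c _ not-low min-above _ _ _ _ _ r) =
    recolor-certified no-loop degree
      (recolorAt-certified s x k c _ all-certified
        (rand-certificate s x k no-loop degree not-low min-above)) r

  recolor-invariant : ∀ {s : State n Δ} {x s'} → Recolor s x s' → Invariant s → Invariant s'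
  recolor-invariant r inv = record
    { loopless  = subst Loopless (sym same-edges) (loopless inv)
    ; degree    = subst (DegreeAtMost Δ) (sym same-edges) (degree inv)
    ; certified = recolor-certified (loopless inv) (degree inv) (certified inv) r }
    where same-edges = recolor-keeps-edges r

  touches : Fin n → Fin n → Fin n → Fin n → Bool
  touches u w a a' = ((a ==ᶠ u) ∧ (a' ==ᶠ w)) ∨ ((a ==ᶠ w) ∧ (a' ==ᶠ u))

  touches-diagonal : ∀ u w a → touches u w a a ≡ true → u ≡ w
  touches-diagonal u w a hit with a ==ᶠ u in a=u | a ==ᶠ w in a=w
  ... | true | true = trans (sym (==ᶠ-sound a=u)) (==ᶠ-sound a=w)
  touches-diagonal u w a () | true  | false
  touches-diagonal u w a () | false | true
  touches-diagonal u w a () | false | false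

  setEdge-loopless : (s : State n Δ) (u w : Fin n) (b : Bool) → ¬ u ≡ w →
    Loopless (adj s) → Loopless (adj (setEdge s u w b))
  setEdge-loopless s u w b u≢w no-loop a with touches u w a a in hit
  ... | true  = ⊥-elim (u≢w (touches-diagonal u w a hit))
  ... | false = no-loop a

  setEdge-other-degree : (s : State n Δ) (u w a : Fin n) (b : Bool) → ¬ a ≡ u → ¬ a ≡ w →
    deg (setEdge s u w b) a ≡ deg s a
  setEdge-other-degree s u w a b a≢u a≢w = count-cong untouched
    where
    untouched : ∀ a' → adj (setEdge s u w b) a a' ≡ adj s a a'
    untouched a' rewrite ==ᶠ-complete a≢u | ==ᶠ-complete a≢w = refl

  -- Insertions preserve the invariant: Insertable bounds the two new
  -- degrees, all other degrees are unchanged.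
  insert-invariant : (s : State n Δ) (u w : Fin n) → Insertable s u w →
    Invariant s → Invariant (setEdge s u w true)
  insert-invariant s u w (u≢w , _ , deg-u , deg-w) inv = record
    { loopless  = setEdge-loopless s u w true u≢w (loopless inv)
    ; degree    = bounded
    ; certified = certified inv }
    where
    bounded : DegreeAtMost Δ (adj (setEdge s u w true))
    bounded a = by-cases (a ≟ u) (a ≟ w)
      where
      by-cases : Dec (a ≡ u) → Dec (a ≡ w) → deg (setEdge s u w true) a ≤ Δ
      by-cases (yes refl) _          = deg-u
      by-cases (no _)     (yes refl) = deg-w
      by-cases (no a≢u)   (no a≢w)   =
        subst (_≤ Δ) (sym (setEdge-other-degree s u w a true a≢u a≢w)) (degree inv a)

  -- Deletions preserve the invariant: an existing edge is not a loop, and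
  -- removing it only lowers degrees.
  delete-invariant : (s : State n Δ) (u w : Fin n) → adj s u w ≡ true →
    Invariant s → Invariant (setEdge s u w false)
  delete-invariant s u w uw inv = record
    { loopless  = setEdge-loopless s u w false u≢w (loopless inv)
    ; degree    = λ a → ≤-trans (count-mono (removed-only a)) (degree inv a)
    ; certified = certified inv }
    where
    u≢w : ¬ u ≡ w
    u≢w refl with () ← trans (sym uw) (loopless inv u)
    removed-only : ∀ a a' → adj (setEdge s u w false) a a' ≡ true → adj s a a' ≡ true
    removed-only a a' present with touches u w a a'
    ... | false = present

  update-invariant : ∀ {s s' : State n Δ} → Update s s' → Invariant s → Invariant s'
  update-invariant {s} (delete u w uw)                = delete-invariant s u w uw
  update-invariant {s} (insert-diff u w insertable _) = insert-invariant s u w insertable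
  update-invariant {s} (insert-same u w _ insertable _ _ r) =
    recolor-invariant r ∘ insert-invariant s u w insertable

  reachable-invariant : ∀ {col₀} {s : State n Δ} → Reach col₀ s → Invariant s
  reachable-invariant start = record
    { loopless  = λ _ → refl
    ; degree    = λ _ → subst (_≤ Δ) (sym no-edges) z≤n
    ; certified = λ _ → refl }
    where
    no-edges : countᵇ (λ _ → false) (allFin n) ≡ 0
    no-edges = trans (count-allFin {n} (λ _ → false)) (sum-replicate-zero n)
  reachable-invariant (step reach update) =
    update-invariant update (reachable-invariant reach)

certified-cases : ∀ {k r} → Certified k r →
  (1 ≤ k → Σ ℕ (λ p → Σ ℕ (λ d → r ≡ rand p d × 3 ^ k + 2 ≤ 2 * p × 3 ^ k ≤ d)))
  × (k ≡ 0 → r ≡ det)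
certified-cases {zero}  r≡det       = (λ ()) , (λ _ → r≡det)
certified-cases {suc k} certificate = (λ _ → certificate) , (λ ())

lemma2 : (n Δ : ℕ) → 0 < Δ → (col₀ : Fin n → Fin (suc Δ)) →
         (s : State n Δ) → Reach col₀ s → (v : Fin n) →
         (1 ≤ lvl s v →
            Σ ℕ (λ p → Σ ℕ (λ d →
              last s v ≡ rand p d × 3 ^ lvl s v + 2 ≤ 2 * p × 3 ^ lvl s v ≤ d)))
         × (lvl s v ≡ 0 → last s v ≡ det)
lemma2 n Δ _ col₀ s reach v =
  certified-cases (Invariant.certified (reachable-invariant reach) v)
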